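{- Let $\mathcal R$ and $\mathcal S$ be TRSs, $T$ a set of terms, and $\mathcal A$ a matrix interpretation of degree $d$. Suppose $\mathcal R/\mathcal S$ is terminating, $\mathcal A$ admits a weight gap $\Delta$ on $T$ (for $\mathcal R/\mathcal S$), and $\mathcal S$ is compatible with $\mathcal A$. Then there exists $c\in\mathbb N$ such that $\mathrm{dh}(t,\to_{\mathcal R\cup\mathcal S})\le(1+\Delta)\cdot\mathrm{dh}(t,\to_{\mathcal R/\mathcal S})+c\cdot|t|^d$ for all $t\in T$. Consequently $\mathrm{comp}(n,T,\to_{\mathcal R\cup\mathcal S})=O(\mathrm{comp}(n,T,\to_{\mathcal R/\mathcal S})+n^d)$.
   Context: TRSs are finite sets of rewrite rules over a signature $\mathcal F$ and variables $\mathcal V$. The relative rewrite relation is $s\to_{\mathcal R/\mathcal S}t$ iff $s\to_{\mathcal S}^*\cdot\to_{\mathcal R}\cdot\to_{\mathcal S}^* t$; $\mathcal R/\mathcal S$ is terminating if this relation is well-founded. $|t|$ is the number of symbol and variable occurrences in $t$. For a relation $\to$, $\mathrm{dh}(s,\to)=\max\{n\mid\exists t.\ s\to^n t\}$, and $\mathrm{comp}(n,T,\to)=\max\{\mathrm{dh}(t,\to)\mid t\in T,\ |t|\le n\}$. A matrix interpretation $\mathcal A$ of dimension $k$ assigns to each $n$-ary symbol $f$ a map $f_{\mathcal A}(\vec v_1,\dots,\vec v_n)=F_1\vec v_1+\cdots+F_n\vec v_n+\vec f$ with $F_i\in\mathbb N^{k\times k}$, $\vec f\in\mathbb N^k$;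 $[\alpha]_{\mathcal A}(t)$ is the evaluation under an assignment $\alpha:\mathcal V\to\mathbb N^k$, and $[t]$ is the evaluation under the assignment mapping all variables to $\vec 0$, $[t]_j$ its $j$-th component. On $\mathbb N^k$, $\vec x>\vec y$ iff $x_1>y_1$ and $x_j\ge y_j$ for $j\ge2$. $\mathcal S$ is compatible with $\mathcal A$ if $[\alpha]_{\mathcal A}(l)>[\alpha]_{\mathcal A}(r)$ for every $l\to r\in\mathcal S$ and every $\alpha$. $\mathcal A$ is of degree $d$ if there is $c$ with $[t]_j\le c\cdot|t|^d$ for all terms $t$ and all $j$. A weight gap on $T$ (for $\mathcal R/\mathcal S$ and $\mathcal A$) is a number $\Delta\in\mathbb N$ such that whenever $s_0\to^*_{\mathcal R\cup\mathcal S}s$ for some $s_0\in T$ and $s\to_{\mathcal R}t$, we have $[t]_1-[s]_1\le\Delta$. -}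

module Defs where

open import Data.Nat using (ℕ; zero; suc; _+_; _*_; _∸_; _^_; _≤_; _<_)
open import Data.Fin using (Fin; zero; suc)
open import Data.Vec using (Vec; []; _∷_; lookup; _[_]≔_)
open import Data.List using (List)
open import Data.List.Membership.Propositional using (_∈_)
open import Data.Product using (Σ; ∃; _×_; _,_)
open import Data.Sum using (_⊎_)
open import Relation.Binary using (Rel)
open import Relation.Binary.PropositionalEquality using (_≡_)
open import Relation.Binary.Construct.Closure.ReflexiveTransitive using (Star)
open import Induction.WellFounded using (WellFounded)
open import Function using (flip)
open import Level using (0ℓ)

record Signature : Set₁ where
  field
    Sym   : Set
    arity : Sym → ℕ
open Signature public

FiniteSig : Signature → Set
FiniteSig 𝓕 = Σ (List (Sym 𝓕)) λ fs → ∀ f → f ∈ fs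

module _ (𝓕 : Signature) where
  data Term : Set where
    var : ℕ → Term
    fun : (f : Sym 𝓕) → Vec Term (arity 𝓕 f) → Term

module _ {𝓕 : Signature} where

  mutual
    size : Term 𝓕 → ℕ
    size (var x)    = 1
    size (fun f ts) = suc (sizes ts)

    sizes : ∀ {n} → Vec (Term 𝓕) n → ℕ
    sizes []       = 0
    sizes (t ∷ ts) = size t + sizes ts

  Subst : Set
  Subst = ℕ → Term 𝓕

  mutual
    _⟨_⟩ : Term 𝓕 → Subst → Term 𝓕
    var x    ⟨ σ ⟩ = σ x
    fun f ts ⟨ σ ⟩ = fun f (substs ts σ)

    substs : ∀ {n} → Vec (Term 𝓕) n → Subst → Vec (Term 𝓕) n
    substs []       σ = []
    substs (t ∷ ts) σ = (t ⟨ σ ⟩) ∷ substs ts σ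

  data _∈V_ (x : ℕ) : Term 𝓕 → Set where
    here : x ∈V var x
    arg  : ∀ {f ts} (i : Fin (arity 𝓕 f)) → x ∈V lookup ts i → x ∈V fun f ts

Rule : Signature → Set
Rule 𝓕 = Term 𝓕 × Term 𝓕

TRS : Signature → Set
TRS 𝓕 = List (Rule 𝓕)

module _ {𝓕 : Signature} where

  WellFormedRule : Rule 𝓕 → Set
  WellFormedRule (l , r) = (∀ x → l ≡ var x → Data.Empty.⊥) × (∀ x → x ∈V r → x ∈V l)
    where import Data.Empty

  WellFormedTRS : TRS 𝓕 → Set
  WellFormedTRS R = ∀ {ρ} → ρ ∈ R → WellFormedRule ρ

  data Step (R : TRS 𝓕) : Rel (Term 𝓕) 0ℓ where
    root : ∀ {l r} (σ : Subst) → (l , r) ∈ R → Step R (l ⟨ σ ⟩) (r ⟨ σ ⟩)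
    ctx  : ∀ {f ts u} (i : Fin (arity 𝓕 f)) → Step R (lookup ts i) u →
           Step R (fun f ts) (fun f (ts [ i ]≔ u))

  StepU : TRS 𝓕 → TRS 𝓕 → Rel (Term 𝓕) 0ℓ
  StepU R S s t = Step R s t ⊎ Step S s t

  StepRel : TRS 𝓕 → TRS 𝓕 → Rel (Term 𝓕) 0ℓ
  StepRel R S s t = ∃ λ u → ∃ λ v → Star (Step S) s u × Step R u v × Star (Step S) v t

data Pow {A : Set} (_⇒_ : Rel A 0ℓ) : ℕ → Rel A 0ℓ where
  done : ∀ {s} → Pow _⇒_ zero s s
  step : ∀ {n s u t} → s ⇒ u → Pow _⇒_ n u t → Pow _⇒_ (suc n) s t

Terminating : {A : Set} → Rel A 0ℓ → Set
Terminating _⇒_ = WellFounded (flip _⇒_)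

-- dh(s, →) ≤ m   (dh = max{n | ∃t. s →ⁿ t}, read in ℕ ∪ {∞})
DhLe : {A : Set} → Rel A 0ℓ → A → ℕ → Set
DhLe _⇒_ s m = ∀ n t → Pow _⇒_ n s t → n ≤ m

module _ {𝓕 : Signature} where
  CompLe : Rel (Term 𝓕) 0ℓ → (Term 𝓕 → Set) → ℕ → ℕ → Set
  CompLe _⇒_ T n M = ∀ t → T t → size t ≤ n → DhLe _⇒_ t M

sumFin : ∀ {n} → (Fin n → ℕ) → ℕ
sumFin {zero}  g = 0
sumFin {suc n} g = g zero + sumFin (λ i → g (suc i))

NVec : ℕ → Set
NVec k = Fin k → ℕ

Mat : ℕ → Set
Mat k = Fin k → Fin k → ℕ

_·ᵥ_ : ∀ {k} → Mat k → NVec k → NVec k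
(A ·ᵥ v) i = sumFin (λ j → A i j * v j)

_⊕_ : ∀ {k} → NVec k → NVec k → NVec k
(v ⊕ w) i = v i + w i

𝟎 : ∀ {k} → NVec k
𝟎 _ = 0

_>ᵥ_ : ∀ {k} → NVec (suc k) → NVec (suc k) → Set
v >ᵥ w = (w zero < v zero) × (∀ j → w (suc j) ≤ v (suc j))

-- f_A(v₁,…,vₙ) = F₁v₁ + ⋯ + Fₙvₙ + f⃗ ; monotone: top-left entry of each Fᵢ is ≥ 1
-- MatrixInterpretation 𝓕 k has dimension suc k (dimension ≥ 1, so component 1 exists)
record MatrixInterpretation (𝓕 : Signature) (k : ℕ) : Set where
  field
    coef     : (f : Sym 𝓕) → Fin (arity 𝓕 f) → Mat (suc k)
    const    : (f : Sym 𝓕) → NVec (suc k)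
    monotone : ∀ f i → 1 ≤ coef f i zero zero
open MatrixInterpretation public

module _ {𝓕 : Signature} {k′ : ℕ} (𝓐 : MatrixInterpretation 𝓕 k′) where
  private
    k = suc k′
  mutual
    eval : (ℕ → NVec k) → Term 𝓕 → NVec k
    eval α (var x)    = α x
    eval α (fun f ts) = evalArgs α (coef 𝓐 f) ts ⊕ const 𝓐 f

    evalArgs : ∀ {n} → (ℕ → NVec k) → (Fin n → Mat k) → Vec (Term 𝓕) n → NVec k
    evalArgs α M []       = 𝟎
    evalArgs α M (t ∷ ts) = (M zero ·ᵥ eval α t) ⊕ evalArgs α (λ i → M (suc i)) ts

  ⟦_⟧ : Term 𝓕 → NVec k
  ⟦ t ⟧ = eval (λ _ → 𝟎) t

  HasDegree : ℕ → Set
  HasDegree d = ∃ λ c → ∀ (t : Term 𝓕) (j : Fin k) → ⟦ t ⟧ j ≤ c * size t ^ d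

module _ {𝓕 : Signature} {k : ℕ} (𝓐 : MatrixInterpretation 𝓕 k) where
  Compatible : TRS 𝓕 → Set
  Compatible S = ∀ {l r} → (l , r) ∈ S → ∀ (α : ℕ → NVec (suc k)) → eval 𝓐 α l >ᵥ eval 𝓐 α r

  WeightGap : TRS 𝓕 → TRS 𝓕 → (Term 𝓕 → Set) → ℕ → Set
  WeightGap R S T Δ = ∀ s₀ s t → T s₀ → Star (StepU R S) s₀ s → Step R s t →
                      ⟦ 𝓐 ⟧ t zero ∸ ⟦ 𝓐 ⟧ s zero ≤ Δ

-- Let W t be the first component of [t]. Compatibility makes every S-step strictly
-- decrease W (the top-left entries of the matrices are positive, so a decrease in a
-- subterm propagates to the root), while the weight gap lets every R-step increase W
-- by at most Δ. Hence in an (R ∪ S)-derivation from t the S-steps are paid for by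
-- W t ≤ c·|t|^d plus Δ per R-step, so a derivation with r R-steps has length at most
-- (1 + Δ)·r + W t. Absorbing each S-step into a neighbouring relative step turns it
-- into an R/S-derivation of length r, so r ≤ dh(t, →_{R/S}).
module Submission where

open import Defs
open import Data.Nat using (ℕ; zero; suc; _+_; _*_; _^_; _≤_; _<_; _∸_; z≤n; s≤s; >-nonZero)
open import Data.Nat.Properties
open import Data.Nat.Tactic.RingSolver using (solve-∀)
open import Data.Product using (∃; ∃₂; _×_; _,_; proj₁)
open import Data.Sum using (_⊎_; inj₁; inj₂)
open import Data.Fin using (Fin; zero; suc)
open import Data.Vec using (Vec; []; _∷_; lookup; _[_]≔_)
open import Level using (0ℓ)
open import Relation.Binary using (Rel)
open import Relation.Binary.PropositionalEquality using (_≡_; refl; sym; cong; cong₂; subst₂)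
open import Relation.Binary.Construct.Closure.ReflexiveTransitive using (Star; ε; _◅_; _◅◅_)

module WeightedDerivations {A : Set} (_⇒R_ _⇒S_ : Rel A 0ℓ) where

  _⇒∪_ : Rel A 0ℓ
  s ⇒∪ t = s ⇒R t ⊎ s ⇒S t

  _⇒/_ : Rel A 0ℓ
  s ⇒/ t = ∃₂ λ u v → Star _⇒S_ s u × u ⇒R v × Star _⇒S_ v t

  Pow-/-prepend-S : ∀ {r s s′ u} → s ⇒S s′ → Pow _⇒/_ r s′ u → ∃ λ u′ → Pow _⇒/_ r s u′
  Pow-/-prepend-S s⇒s′ done = _ , done
  Pow-/-prepend-S s⇒s′ (step (u , v , s′⇒*u , u⇒v , v⇒*t) rest) =
    _ , step (u , v , s⇒s′ ◅ s′⇒*u , u⇒v , v⇒*t) rest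

  module _ (W : A → ℕ) (Δ : ℕ) {s₀ : A}
           (R-gap : ∀ {s t} → Star _⇒∪_ s₀ s → s ⇒R t → W t ∸ W s ≤ Δ)
           (S-decreasing : ∀ {s t} → s ⇒S t → W t < W s) where

    Pow-∪⇒Pow-/ : ∀ {n s u} → Star _⇒∪_ s₀ s → Pow _⇒∪_ n s u →
                  ∃₂ λ r u′ → Pow _⇒/_ r s u′ × n ≤ r * (1 + Δ) + W s
    Pow-∪⇒Pow-/ s₀⇒*s done = 0 , _ , done , z≤n
    Pow-∪⇒Pow-/ {suc n} {s} s₀⇒*s (step {u = s′} (inj₁ s⇒s′) rest)
      with Pow-∪⇒Pow-/ (s₀⇒*s ◅◅ inj₁ s⇒s′ ◅ ε) rest
    ... | r , u′ , rel , n≤ = suc r , u′ , step (s , s′ , ε , s⇒s′ , ε) rel , s≤s (begin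
      n                       ≤⟨ n≤ ⟩
      r * (1 + Δ) + W s′      ≤⟨ +-monoʳ-≤ (r * (1 + Δ)) W-s′≤ ⟩
      r * (1 + Δ) + (W s + Δ) ≡⟨ regroup (r * (1 + Δ)) (W s) Δ ⟩
      Δ + r * (1 + Δ) + W s   ∎)
      where
        open ≤-Reasoning
        W-s′≤ : W s′ ≤ W s + Δ
        W-s′≤ = ≤-trans (m≤n+m∸n (W s′) (W s)) (+-monoʳ-≤ (W s) (R-gap s₀⇒*s s⇒s′))
        regroup : ∀ x w δ → x + (w + δ) ≡ δ + x + w
        regroup = solve-∀
    Pow-∪⇒Pow-/ {suc n} {s} s₀⇒*s (step {u = s′} (inj₂ s⇒s′) rest)
      with Pow-∪⇒Pow-/ (s₀⇒*s ◅◅ inj₂ s⇒s′ ◅ ε) rest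
    ... | r , _ , rel , n≤ with Pow-/-prepend-S s⇒s′ rel
    ... | u′ , rel′ = r , u′ , rel′ , (begin
      suc n                    ≤⟨ s≤s n≤ ⟩
      suc (r * (1 + Δ) + W s′) ≡⟨ sym (+-suc (r * (1 + Δ)) (W s′)) ⟩
      r * (1 + Δ) + suc (W s′) ≤⟨ +-monoʳ-≤ (r * (1 + Δ)) (S-decreasing s⇒s′) ⟩
      r * (1 + Δ) + W s        ∎)
      where open ≤-Reasoning

sumFin-cong : ∀ {n} (f g : Fin n → ℕ) → (∀ j → f j ≡ g j) → sumFin f ≡ sumFin g
sumFin-cong {zero}  f g f≡g = refl
sumFin-cong {suc n} f g f≡g =
  cong₂ _+_ (f≡g zero) (sumFin-cong (λ j → f (suc j)) (λ j → g (suc j)) (λ j → f≡g (suc j)))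

sumFin-mono-≤ : ∀ {n} (f g : Fin n → ℕ) → (∀ j → f j ≤ g j) → sumFin f ≤ sumFin g
sumFin-mono-≤ {zero}  f g f≤g = z≤n
sumFin-mono-≤ {suc n} f g f≤g =
  +-mono-≤ (f≤g zero) (sumFin-mono-≤ (λ j → f (suc j)) (λ j → g (suc j)) (λ j → f≤g (suc j)))

sumFin-mono-< : ∀ {n} (f g : Fin (suc n) → ℕ) →
                f zero < g zero → (∀ j → f j ≤ g j) → sumFin f < sumFin g
sumFin-mono-< f g f₀<g₀ f≤g =
  +-mono-<-≤ f₀<g₀ (sumFin-mono-≤ (λ j → f (suc j)) (λ j → g (suc j)) (λ j → f≤g (suc j)))

>ᵥ⇒≥ : ∀ {k} {v w : NVec (suc k)} → v >ᵥ w → ∀ j → w j ≤ v j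
>ᵥ⇒≥ (w₀<v₀ , _)   zero    = <⇒≤ w₀<v₀
>ᵥ⇒≥ (_     , w≤v) (suc j) = w≤v j

·ᵥ-monoʳ->ᵥ : ∀ {k} (M : Mat (suc k)) → 1 ≤ M zero zero →
              ∀ v w → v >ᵥ w → (M ·ᵥ v) >ᵥ (M ·ᵥ w)
·ᵥ-monoʳ->ᵥ M 1≤M₀₀ v w v>w =
  sumFin-mono-< (λ j → M zero j * w j) (λ j → M zero j * v j)
    (*-monoʳ-< (M zero zero) {{>-nonZero 1≤M₀₀}} (proj₁ v>w)) (row≤ zero)
  , λ i → sumFin-mono-≤ (λ j → M (suc i) j * w j) (λ j → M (suc i) j * v j) (row≤ (suc i))
  where
    row≤ : ∀ i j → M i j * w j ≤ M i j * v j
    row≤ i j = *-monoʳ-≤ (M i j) (>ᵥ⇒≥ {v = v} {w} v>w j)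

⊕-monoˡ->ᵥ : ∀ {k} (x v w : NVec (suc k)) → v >ᵥ w → (v ⊕ x) >ᵥ (w ⊕ x)
⊕-monoˡ->ᵥ x v w (w₀<v₀ , w≤v) = +-monoˡ-< (x zero) w₀<v₀ , λ j → +-monoˡ-≤ (x (suc j)) (w≤v j)

⊕-monoʳ->ᵥ : ∀ {k} (x v w : NVec (suc k)) → v >ᵥ w → (x ⊕ v) >ᵥ (x ⊕ w)
⊕-monoʳ->ᵥ x v w (w₀<v₀ , w≤v) = +-monoʳ-< (x zero) w₀<v₀ , λ j → +-monoʳ-≤ (x (suc j)) (w≤v j)

module _ {𝓕 : Signature} {k : ℕ} (𝓐 : MatrixInterpretation 𝓕 k) where

  mutual
    eval-⟨⟩ : ∀ α (σ : Subst) (t : Term 𝓕) j →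
              eval 𝓐 α (t ⟨ σ ⟩) j ≡ eval 𝓐 (λ x → eval 𝓐 α (σ x)) t j
    eval-⟨⟩ α σ (var x)    j = refl
    eval-⟨⟩ α σ (fun f ts) j = cong (_+ const 𝓐 f j) (evalArgs-substs α σ (coef 𝓐 f) ts j)

    evalArgs-substs : ∀ {n} α (σ : Subst) (M : Fin n → Mat (suc k)) (ts : Vec (Term 𝓕) n) j →
                      evalArgs 𝓐 α M (substs ts σ) j ≡ evalArgs 𝓐 (λ x → eval 𝓐 α (σ x)) M ts j
    evalArgs-substs α σ M []       j = refl
    evalArgs-substs α σ M (t ∷ ts) j =
      cong₂ _+_ (sumFin-cong _ _ (λ i → cong (M zero j i *_) (eval-⟨⟩ α σ t i)))
                (evalArgs-substs α σ (λ i → M (suc i)) ts j)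

  evalArgs-mono->ᵥ : ∀ {n} α (M : Fin n → Mat (suc k)) → (∀ i → 1 ≤ M i zero zero) →
                     (ts : Vec (Term 𝓕) n) (i : Fin n) (u : Term 𝓕) →
                     eval 𝓐 α (lookup ts i) >ᵥ eval 𝓐 α u →
                     evalArgs 𝓐 α M ts >ᵥ evalArgs 𝓐 α M (ts [ i ]≔ u)
  evalArgs-mono->ᵥ α M pos (t ∷ ts) zero u t>u =
    ⊕-monoˡ->ᵥ (evalArgs 𝓐 α (λ i → M (suc i)) ts) (M zero ·ᵥ eval 𝓐 α t) (M zero ·ᵥ eval 𝓐 α u)
      (·ᵥ-monoʳ->ᵥ (M zero) (pos zero) (eval 𝓐 α t) (eval 𝓐 α u) t>u)
  evalArgs-mono->ᵥ α M pos (t ∷ ts) (suc i) u tᵢ>u =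
    ⊕-monoʳ->ᵥ (M zero ·ᵥ eval 𝓐 α t)
      (evalArgs 𝓐 α (λ j → M (suc j)) ts) (evalArgs 𝓐 α (λ j → M (suc j)) (ts [ i ]≔ u))
      (evalArgs-mono->ᵥ α (λ j → M (suc j)) (λ j → pos (suc j)) ts i u tᵢ>u)

  Compatible⇒Step->ᵥ : ∀ {S} → Compatible 𝓐 S →
                       ∀ α {s t} → Step S s t → eval 𝓐 α s >ᵥ eval 𝓐 α t
  Compatible⇒Step->ᵥ compat α (root {l} {r} σ l→r∈S)
    with compat l→r∈S (λ x → eval 𝓐 α (σ x))
  ... | r₀<l₀ , r≤l =
    subst₂ _<_ (sym (eval-⟨⟩ α σ r zero)) (sym (eval-⟨⟩ α σ l zero)) r₀<l₀ ,
    λ j → subst₂ _≤_ (sym (eval-⟨⟩ α σ r (suc j))) (sym (eval-⟨⟩ α σ l (suc j))) (r≤l j)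
  Compatible⇒Step->ᵥ compat α (ctx {f} {ts} {u} i s→u) =
    ⊕-monoˡ->ᵥ (const 𝓐 f) (evalArgs 𝓐 α (coef 𝓐 f) ts) (evalArgs 𝓐 α (coef 𝓐 f) (ts [ i ]≔ u))
      (evalArgs-mono->ᵥ α (coef 𝓐 f) (monotone 𝓐 f) ts i u (Compatible⇒Step->ᵥ compat α s→u))

  dh-∪-≤ : ∀ (R S : TRS 𝓕) (T : Term 𝓕 → Set) (Δ : ℕ) → WeightGap 𝓐 R S T Δ → Compatible 𝓐 S →
           ∀ c d → (∀ t → ⟦ 𝓐 ⟧ t zero ≤ c * size t ^ d) →
           ∀ t → T t → ∀ m → DhLe (StepRel R S) t m →
           DhLe (StepU R S) t ((1 + Δ) * m + c * size t ^ d)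
  dh-∪-≤ R S T Δ gap compat c d W≤ t Tt m dh/≤m n u t⇒ⁿu
    with Pow-∪⇒Pow-/ (λ t → ⟦ 𝓐 ⟧ t zero) Δ (gap t _ _ Tt)
           (λ s⇒t → proj₁ (Compatible⇒Step->ᵥ compat (λ _ → 𝟎) s⇒t)) ε t⇒ⁿu
    where open WeightedDerivations (Step R) (Step S)
  ... | r , u′ , t⇒/ʳu′ , n≤ = begin
    n                              ≤⟨ n≤ ⟩
    r * (1 + Δ) + ⟦ 𝓐 ⟧ t zero     ≡⟨ cong (_+ ⟦ 𝓐 ⟧ t zero) (*-comm r (1 + Δ)) ⟩
    (1 + Δ) * r + ⟦ 𝓐 ⟧ t zero     ≤⟨ +-mono-≤ (*-monoʳ-≤ (1 + Δ) (dh/≤m r u′ t⇒/ʳu′)) (W≤ t) ⟩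
    (1 + Δ) * m + c * size t ^ d   ∎
    where open ≤-Reasoning

a*m+c*p≤[a+c]*[m+p] : ∀ a c m p → a * m + c * p ≤ (a + c) * (m + p)
a*m+c*p≤[a+c]*[m+p] a c m p = begin
  a * m + c * p                     ≤⟨ m≤m+n _ _ ⟩
  (a * m + c * p) + (a * p + c * m) ≡⟨ expand a c m p ⟩
  (a + c) * (m + p)                 ∎
  where
    open ≤-Reasoning
    expand : ∀ a c m p → (a * m + c * p) + (a * p + c * m) ≡ (a + c) * (m + p)
    expand = solve-∀

theorem44 : (𝓕 : Signature) → FiniteSig 𝓕 →
    (R S : TRS 𝓕) → WellFormedTRS R → WellFormedTRS S →
    (T : Term 𝓕 → Set) →
    (k : ℕ) (𝓐 : MatrixInterpretation 𝓕 k) (d : ℕ) → HasDegree 𝓐 d →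
    (Δ : ℕ) →
    Terminating (StepRel R S) →
    WeightGap 𝓐 R S T Δ →
    Compatible 𝓐 S →
    ∃ (λ c → ∀ t → T t → ∀ m → DhLe (StepRel R S) t m →
                 DhLe (StepU R S) t ((1 + Δ) * m + c * size t ^ d))
    × ∃ (λ C → ∃ λ N → ∀ n → N ≤ n → ∀ M → CompLe (StepRel R S) T n M →
                 CompLe (StepU R S) T n (C * (M + n ^ d)))
theorem44 𝓕 _ R S _ _ T k 𝓐 d (c , degree) Δ _ gap compat =
  (c , dh-bound) , (1 + Δ + c , 0 , comp-bound)
  where
    dh-bound : ∀ t → T t → ∀ m → DhLe (StepRel R S) t m →
               DhLe (StepU R S) t ((1 + Δ) * m + c * size t ^ d)
    dh-bound = dh-∪-≤ 𝓐 R S T Δ gap compat c d (λ t → degree t zero)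

    comp-bound : ∀ n → 0 ≤ n → ∀ M → CompLe (StepRel R S) T n M →
                 CompLe (StepU R S) T n ((1 + Δ + c) * (M + n ^ d))
    comp-bound n _ M comp/ t Tt |t|≤n m u t⇒ᵐu =
      ≤-trans (dh-bound t Tt M (comp/ t Tt |t|≤n) m u t⇒ᵐu)
        (≤-trans (+-monoʳ-≤ ((1 + Δ) * M) (*-monoʳ-≤ c (^-monoˡ-≤ d |t|≤n)))
                 (a*m+c*p≤[a+c]*[m+p] (1 + Δ) c M (n ^ d)))
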